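{- Let $G$ be a graph on the vertex set $\{1,\ldots,n\}$ such that $(1,2,\ldots,n-1,n,1)$ is a Hamilton cycle of $G$, denoted $H$. Suppose a set of chords $R \subseteq E(G)\setminus E(H)$ has the property that for any two distinct $e,e' \in R$ there is at most one chord $e'' \in R\setminus\{e,e'\}$ with $|C(e,e')| = |C(e,e'')|$. Then there exists a subset $F \subseteq R$ of size $|F| = \sqrt{|R|}$ such that $|\mathcal{S}(H+F)| \ge |R|/24$.
   Context: For a graph $G'$, $\mathcal{S}(G')$ denotes its cycle set: the set of all integers $\ell$ such that $G'$ contains a cycle with exactly $\ell$ vertices. $H+F$ denotes the graph on $\{1,\ldots,n\}$ with edge set $E(H)\cup F$. Edges of $G$ not in $E(H)$ are called chords. For an edge $e$, write its endpoints as $(a_e,b_e)$ with $a_e<b_e$. For two distinct chords $e,e'$, the cycle $C(e,e')$ is defined as follows. Consider the cycles in $H+\{e,e'\}$ that use both $e$ and $e'$ (all other edges from $H$). If there is exactly one such cycle, which happens when $\{a_e,b_e\}\cap\{a_{e'},b_{e'}\}\neq\emptyset$, or $b_e<a_{e'}$, or $b_{e'}<a_e$, or ($a_e<a_{e'}$ if and only if $b_{e'}<b_e$), then $C(e,e')$ is that cycle. Otherwise $a_e<a_{e'}<b_e<b_{e'}$ (or the same with $e,e'$ swapped); if $a_e<a_{e'}$, then $C(e,e')$ is the cycle that goes from $a_e$ to $b_e$ along $e$, then from $b_e$ to $b_{e'}$ along $H$ through increasing labels, then from $b_{e'}$ to $a_{e'}$ along $e'$, then from $a_{e'}$ back to $a_e$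 along $H$ through decreasing labels; if $a_e>a_{e'}$, then $C(e,e'):=C(e',e)$. $|C|$ denotes the number of vertices of a cycle $C$. The paper tacitly ignores floors and ceilings (so $|F|=\sqrt{|R|}$ is to be read up to rounding). -}

module Defs where

open import Data.Nat using (ℕ; zero; suc; _+_; _*_; _∸_; _≤_; _<_; _<ᵇ_; _≡ᵇ_)
open import Data.Bool using (Bool; true; false; if_then_else_)
open import Data.Product using (_×_; _,_; Σ; ∃)
open import Data.Sum using (_⊎_)
open import Data.List using (List; []; _∷_; _++_; map; upTo; reverse; length; [_])
open import Data.List.Membership.Propositional using (_∈_)
open import Data.List.Relation.Unary.All using (All)
open import Data.List.Relation.Unary.Unique.Propositional using (Unique)
open import Data.List.Relation.Unary.Linked using (Linked)
open import Relation.Binary.PropositionalEquality using (_≡_)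
open import Relation.Nullary using (¬_)

-- Vertices are natural numbers 1..n.  An edge is an ordered pair (a , b)
-- with a < b (the convention a_e < b_e of the paper).
Edge : Set
Edge = ℕ × ℕ

range : ℕ → ℕ → List ℕ
range x y = map (x +_) (upTo (suc (y ∸ x)))

HEdge : ℕ → ℕ → ℕ → Set
HEdge n x y = (1 ≤ x × x < n × y ≡ suc x) ⊎ (1 ≤ y × y < n × x ≡ suc y)
            ⊎ (x ≡ 1 × y ≡ n) ⊎ (x ≡ n × y ≡ 1)

IsChord : ℕ → Edge → Set
IsChord n (a , b) = 1 ≤ a × a < b × b ≤ n × ¬ HEdge n a b

Adj : ℕ → List Edge → ℕ → ℕ → Set
Adj n F x y = HEdge n x y ⊎ (x , y) ∈ F ⊎ (y , x) ∈ F

IsCycle : (ℕ → ℕ → Set) → ℕ → List ℕ → Set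
IsCycle adj n [] = Data.Empty.⊥
  where import Data.Empty
IsCycle adj n (v ∷ vs) =
  3 ≤ length (v ∷ vs) × Unique (v ∷ vs) × All (λ x → 1 ≤ x × x ≤ n) (v ∷ vs)
  × Linked adj ((v ∷ vs) ++ [ v ])

InCycleSet : ℕ → List Edge → ℕ → Set
InCycleSet n F ℓ = Σ (List ℕ) λ vs → IsCycle (Adj n F) n vs × length vs ≡ ℓ

-- The cycle C(e,e') of the paper, as its cyclic vertex sequence, for distinct
-- chords e = (a,b), e' = (c,d) (a<b, c<d).  Cases (with a ≤ c after swapping):
--   a = c, b < d : a -e- b, b..d along H, d -e'- a
--   a = c, d < b : symmetric
--   b < c        : b..c along H, c -e'- d, d..n,1..a along H, a -e- b
--   b = c        : b -e'- d, d..n,1..a along H, a -e- b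
--   c < d < b    : a..c along H, c -e'- d, d..b along H, b -e- a
--   c < d = b    : b -e- a, a..c along H, c -e'- b
--   a < c < b < d (crossing): a -e- b, b..d increasing, d -e'- c,
--                 c..a decreasing (the paper's choice for a_e < a_e')
cycC : ℕ → Edge → Edge → List ℕ
cycC n (a , b) (c , d) =
  if c <ᵇ a then core c d a b else core a b c d
  where
  core : ℕ → ℕ → ℕ → ℕ → List ℕ   -- assumes a ≤ c
  core a b c d =
    if a ≡ᵇ c then (if b <ᵇ d then a ∷ range b d else a ∷ range d b)
    else if b <ᵇ c then range b c ++ range d n ++ range 1 a
    else if b ≡ᵇ c then b ∷ (range d n ++ range 1 a)
    else if d <ᵇ b then range a c ++ range d b
    else if d ≡ᵇ b then b ∷ range a c
    else range b d ++ reverse (range a c)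

cycLen : ℕ → Edge → Edge → ℕ
cycLen n e e' = length (cycC n e e')

{-# OPTIONS --safe #-}
-- Let m = |R| and k = ⌊√m⌋; for k ≤ 1 the Hamilton cycle H itself supplies the one length
-- needed. For k ≥ 2 fix a block A of ⌊k/2⌋ chords and add ⌈k/2⌉ further chords f greedily,
-- recording each time the new values |C(e,f)|, e ∈ A. For fixed e a value |C(e,f)| is taken by
-- at most two chords f, so a recorded list L causes at most 2|A||L| collisions in total with the
-- (at least m/2) chords still available. While 24|L| < m the chord f with fewest collisions
-- therefore collides with at most |A|/6 members of A, and its remaining ≥ 5|A|/6 values, again
-- at most two per length, contribute ≥ 5|A|/12 new lengths. After ⌈k/2⌉ steps
-- |L| ≥ 5⌊k/2⌋⌈k/2⌉/12 ≥ m/24.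
module Submission where

open import Defs
open import Data.Bool using (Bool; true; false; _∨_)
open import Data.Nat
  using (ℕ; zero; suc; _+_; _*_; _∸_; _≤_; _<_; _≟_; _≤?_; _<ᵇ_; _≡ᵇ_;
         ⌊_/2⌋; ⌈_/2⌉; NonZero; >-nonZero; z≤n; s≤s; s≤s⁻¹; z<s; s<s)
open import Data.Nat.Properties
open import Algebra.Properties.CommutativeSemigroup +-commutativeSemigroup
  using () renaming (interchange to +-interchange)
open import Data.Nat.Tactic.RingSolver using (solve-∀)
open import Data.Product using (_×_; _,_; Σ; ∃; ∃₂; proj₁; proj₂)
open import Data.Sum using (_⊎_; inj₁; inj₂; [_,_]′)
open import Data.List
  using (List; []; _∷_; _++_; [_]; length; map; filter; deduplicate; take; drop;
         reverse; upTo; applyUpTo)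
open import Data.List.Properties
  using (length-++; length-take; take++drop≡id; length-map; length-upTo; length-reverse;
         map-applyUpTo; unfold-reverse)
open import Data.List.Extrema.Nat using (argmin; f[argmin]≤f[⊤]; f[argmin]≤f[xs]; argmin-all)
open import Data.List.Membership.Propositional using (_∈_; _∉_)
open import Data.List.Membership.Propositional.Properties
  using (∈-∃++; ∈-map⁺; ∈-map⁻; ∈-deduplicate⁺; ∈-deduplicate⁻; ∈-filter⁻;
         ∈-++⁺ˡ; ∈-++⁺ʳ; ∈-++⁻; ∈-upTo⁻)
open import Data.List.Membership.DecPropositional _≟_ using (_∈?_)
open import Data.List.Relation.Unary.Any using (here; there)
import Data.List.Relation.Unary.Any.Properties as Any
open import Data.List.Relation.Unary.All as All using (All; []; _∷_)
import Data.List.Relation.Unary.All.Properties as All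
open import Data.List.Relation.Unary.Linked using (Linked; []; [-]; _∷_)
open import Data.List.Relation.Unary.Unique.Propositional using (Unique; []; _∷_)
open import Data.List.Relation.Unary.Unique.Propositional.Properties
  using (filter⁺; ++⁺; map⁺; upTo⁺)
open import Data.List.Relation.Unary.Unique.DecPropositional.Properties _≟_ using (deduplicate-!)
open import Data.List.Relation.Binary.Disjoint.Propositional using (Disjoint)
open import Data.List.Relation.Binary.Subset.Propositional using (_⊆_)
open import Data.List.Relation.Binary.Permutation.Propositional
  using (_↭_; ↭-sym; ↭-trans; ↭-reflexive; ↭⇒↭ₛ)
open import Data.List.Relation.Binary.Permutation.Propositional.Properties
  using (∈-resp-↭; All-resp-↭; ↭-length; ↭-reverse; ++⁺ˡ; shift)
import Data.List.Relation.Binary.Permutation.Setoid.Properties as ↭ₛ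
open import Function using (id; _∘_)
open import Relation.Binary using (tri<; tri≈; tri>)
open import Relation.Binary.PropositionalEquality hiding ([_])
open import Relation.Nullary using (¬_; ¬?; does; yes; no; _because_; invert; contradiction)
open import Relation.Nullary.Reflects using (Reflects; ofʸ; ofⁿ; fromEquivalence)
open import Relation.Unary using (Decidable)

private variable
  X : Set
  xs ys : List X

∑ : List X → (X → ℕ) → ℕ
∑ []       h = 0
∑ (x ∷ xs) h = h x + ∑ xs h

syntax ∑ xs (λ x → h) = ∑[ x ∈ xs ] h

∑-+ : ∀ (g h : X → ℕ) xs → ∑[ x ∈ xs ] (g x + h x) ≡ ∑ xs g + ∑ xs h
∑-+ g h []       = refl
∑-+ g h (x ∷ xs) = trans (cong (g x + h x +_) (∑-+ g h xs)) (+-interchange (g x) (h x) _ _)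

∑-mono-≤ : ∀ {g h : X → ℕ} → All (λ x → g x ≤ h x) xs → ∑ xs g ≤ ∑ xs h
∑-mono-≤ []         = z≤n
∑-mono-≤ (le ∷ les) = +-mono-≤ le (∑-mono-≤ les)

∑-const : ∀ (xs : List X) k → ∑[ _ ∈ xs ] k ≡ length xs * k
∑-const []       k = refl
∑-const (_ ∷ xs) k = cong (k +_) (∑-const xs k)

∑-comm : ∀ {Y : Set} (h : X → Y → ℕ) xs (ys : List Y) →
         ∑[ x ∈ xs ] ∑[ y ∈ ys ] h x y ≡ ∑[ y ∈ ys ] ∑[ x ∈ xs ] h x y
∑-comm h []       ys = sym (trans (∑-const ys 0) (*-zeroʳ (length ys)))
∑-comm h (x ∷ xs) ys =
  trans (cong (∑ ys (h x) +_) (∑-comm h xs ys)) (sym (∑-+ (h x) _ ys))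

indicator : Bool → ℕ
indicator true  = 1
indicator false = 0

indicator-∨ : ∀ b b′ → indicator (b ∨ b′) ≤ indicator b + indicator b′
indicator-∨ true  _ = s≤s z≤n
indicator-∨ false _ = ≤-refl

count : {P : X → Set} → Decidable P → List X → ℕ
count P? xs = ∑[ x ∈ xs ] indicator (does (P? x))

module _ {P : X → Set} (P? : Decidable P) where

  count≡length∘filter : ∀ xs → count P? xs ≡ length (filter P? xs)
  count≡length∘filter []       = refl
  count≡length∘filter (x ∷ xs) with does (P? x)
  ... | true  = cong suc (count≡length∘filter xs)
  ... | false = count≡length∘filter xs

  count-all : All P xs → count P? xs ≡ length xs
  count-all {[]}     []         = refl
  count-all {x ∷ xs} (px ∷ pxs) with P? x
  ... | true  because _  = cong suc (count-all pxs)
  ... | false because [¬px] = contradiction px (invert [¬px])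

  count+count-¬ : ∀ xs → count P? xs + count (¬? ∘ P?) xs ≡ length xs
  count+count-¬ []       = refl
  count+count-¬ (x ∷ xs) with does (P? x)
  ... | true  = cong suc (count+count-¬ xs)
  ... | false = trans (+-suc _ _) (cong suc (count+count-¬ xs))

record AtMostTwice (g : X → ℕ) (xs : List X) : Set where
  constructor fibres≤2
  field fibre≤2 : ∀ ℓ → count (λ x → g x ≟ ℓ) xs ≤ 2

-- does (y ∈? ℓ ∷ L) unfolds to does (y ≟ ℓ) ∨ does (y ∈? L).
count-∈≤∑-fibres : ∀ (g : X → ℕ) xs L →
  count (λ x → g x ∈? L) xs ≤ ∑[ ℓ ∈ L ] count (λ x → g x ≟ ℓ) xs
count-∈≤∑-fibres g xs []      = ≤-reflexive (trans (∑-const xs 0) (*-zeroʳ (length xs)))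
count-∈≤∑-fibres g xs (ℓ ∷ L) = begin
  count (λ x → g x ∈? ℓ ∷ L) xs
    ≤⟨ ∑-mono-≤ (All.universal (λ x → indicator-∨ (does (g x ≟ ℓ)) _) xs) ⟩
  ∑[ x ∈ xs ] (indicator (does (g x ≟ ℓ)) + indicator (does (g x ∈? L)))
    ≡⟨ ∑-+ _ _ xs ⟩
  count (λ x → g x ≟ ℓ) xs + count (λ x → g x ∈? L) xs
    ≤⟨ +-monoʳ-≤ _ (count-∈≤∑-fibres g xs L) ⟩
  ∑[ ℓ′ ∈ ℓ ∷ L ] count (λ x → g x ≟ ℓ′) xs ∎
  where open ≤-Reasoning

count-∈≤2*length : ∀ {g : X → ℕ} → AtMostTwice g xs →
  ∀ L → count (λ x → g x ∈? L) xs ≤ 2 * length L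
count-∈≤2*length {xs = xs} {g} twice L = begin
  count (λ x → g x ∈? L) xs            ≤⟨ count-∈≤∑-fibres g xs L ⟩
  ∑[ ℓ ∈ L ] count (λ x → g x ≟ ℓ) xs  ≤⟨ ∑-mono-≤ (All.universal (AtMostTwice.fibre≤2 twice) L) ⟩
  ∑[ _ ∈ L ] 2                         ≡⟨ trans (∑-const L 2) (*-comm (length L) 2) ⟩
  2 * length L                         ∎
  where open ≤-Reasoning

length≤2*distinct-values : ∀ {g : X → ℕ} → AtMostTwice g xs →
  length xs ≤ 2 * length (deduplicate _≟_ (map g xs))
length≤2*distinct-values {xs = xs} {g} twice = begin
  length xs                      ≡⟨ count-all (λ x → g x ∈? values) all-values ⟨
  count (λ x → g x ∈? values) xs ≤⟨ count-∈≤2*length twice values ⟩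
  2 * length values              ∎
  where
  open ≤-Reasoning
  values : List ℕ
  values = deduplicate _≟_ (map g xs)
  all-values : All (λ x → g x ∈ values) xs
  all-values = All.tabulate (λ x∈xs → ∈-deduplicate⁺ _≟_ (∈-map⁺ g x∈xs))

Unique⇒length≤2 : Unique xs →
  (∀ {x y z} → x ∈ xs → y ∈ xs → z ∈ xs → y ≢ x → z ≢ x → y ≡ z) → length xs ≤ 2
Unique⇒length≤2 {xs = []}                 _ _ = z≤n
Unique⇒length≤2 {xs = _ ∷ []}             _ _ = s≤s z≤n
Unique⇒length≤2 {xs = _ ∷ _ ∷ []}         _ _ = s≤s (s≤s z≤n)
Unique⇒length≤2 {xs = _ ∷ _ ∷ _ ∷ _} ((x≢y ∷ x≢z ∷ _) ∷ (y≢z ∷ _) ∷ _) two-apart =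
  contradiction (two-apart (here refl) (there (here refl)) (there (there (here refl)))
                           (≢-sym x≢y) (≢-sym x≢z)) y≢z

Unique-resp-↭ : xs ↭ ys → Unique xs → Unique ys
Unique-resp-↭ p = ↭ₛ.Unique-resp-↭ (setoid _) (↭⇒↭ₛ p)

Unique-++⁻ : ∀ xs → Unique (xs ++ ys) → Unique xs × Unique ys × Disjoint xs ys
Unique-++⁻ []       u          = [] , u , λ ()
Unique-++⁻ (x ∷ xs) (x∉ ∷ u) with Unique-++⁻ xs u
... | uxs , uys , apart =
  All.tabulate (λ z∈xs → All.lookup x∉ (∈-++⁺ˡ z∈xs)) ∷ uxs , uys , λ where
    (here refl , v∈ys)  → All.lookup x∉ (∈-++⁺ʳ xs v∈ys) refl
    (there v∈xs , v∈ys) → apart (v∈xs , v∈ys)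

below-average : ∀ (h : X → ℕ) xs → 0 < length xs →
  ∃ λ y → y ∈ xs × length xs * h y ≤ ∑ xs h
below-average h (x ∷ xs) _ =
  y , argmin-all h (here refl) (All.tabulate there) ,
  ≤-trans (≤-reflexive (sym (∑-const (x ∷ xs) (h y))))
          (∑-mono-≤ (f[argmin]≤f[⊤] {f = h} x xs ∷ f[argmin]≤f[xs] {f = h} x xs))
  where y = argmin h x xs

∈⇒↭∷ : ∀ {x : X} → x ∈ xs → ∃ λ ys → xs ↭ x ∷ ys
∈⇒↭∷ x∈xs with p , q , refl ← ∈-∃++ x∈xs = p ++ q , shift _ p q

less-than-half-used : ∀ {x y m} → x + y ≡ m → 2 * suc x ≤ m → m < 2 * y
less-than-half-used {x} {y} refl room = begin-strict
  x + y      <⟨ +-monoˡ-< y x<y ⟩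
  y + y      ≡⟨ cong (y +_) (+-identityʳ y) ⟨
  2 * y      ∎
  where
  open ≤-Reasoning
  x<y : x < y
  x<y = +-cancelˡ-≤ x (suc x) y (begin
    x + suc x          ≤⟨ +-monoˡ-≤ (suc x) (n≤1+n x) ⟩
    suc x + suc x      ≡⟨ cong (suc x +_) (+-identityʳ (suc x)) ⟨
    2 * suc x          ≤⟨ room ⟩
    x + y              ∎)

collisions≤a/6 : ∀ {p b a L m} → .{{NonZero p}} →
  p * b ≤ a * (2 * L) → 24 * L ≤ m → m ≤ 2 * p → 6 * b ≤ a
collisions≤a/6 {p} {b} {a} {L} {m} pb≤2aL 24L≤m m≤2p =
  *-cancelˡ-≤ 4 (*-cancelˡ-≤ p (begin
    p * (4 * (6 * b))   ≡⟨ e₁ p b ⟩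
    24 * (p * b)        ≤⟨ *-monoʳ-≤ 24 pb≤2aL ⟩
    24 * (a * (2 * L))  ≡⟨ e₂ a L ⟩
    2 * a * (24 * L)    ≤⟨ *-monoʳ-≤ (2 * a) (≤-trans 24L≤m m≤2p) ⟩
    2 * a * (2 * p)     ≡⟨ e₃ a p ⟩
    p * (4 * a)         ∎))
  where
  open ≤-Reasoning
  e₁ : ∀ p b → p * (4 * (6 * b)) ≡ 24 * (p * b)
  e₁ = solve-∀
  e₂ : ∀ a L → 24 * (a * (2 * L)) ≡ 2 * a * (24 * L)
  e₂ = solve-∀
  e₃ : ∀ a p → 2 * a * (2 * p) ≡ p * (4 * a)
  e₃ = solve-∀

new≥5a/12 : ∀ {b x a y} → b + x ≡ a → x ≤ 2 * y → 6 * b ≤ a → 5 * a ≤ 12 * y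
new≥5a/12 {b} {x} {a} {y} refl x≤2y 6b≤a = +-cancelʳ-≤ (b + x) (5 * (b + x)) (12 * y) (begin
  5 * (b + x) + (b + x)    ≡⟨ e₁ b x ⟩
  6 * b + 6 * x            ≤⟨ +-mono-≤ 6b≤a (*-monoʳ-≤ 6 x≤2y) ⟩
  (b + x) + 6 * (2 * y)    ≡⟨ e₂ (b + x) y ⟩
  12 * y + (b + x)         ∎)
  where
  open ≤-Reasoning
  e₁ : ∀ b x → 5 * (b + x) + (b + x) ≡ 6 * b + 6 * x
  e₁ = solve-∀
  e₂ : ∀ a y → a + 6 * (2 * y) ≡ 12 * y + a
  e₂ = solve-∀

k²+2k≤10⌊k/2⌋⌈k/2⌉ : ∀ k → 2 ≤ k → k * k + 2 * k ≤ 10 * (⌊ k /2⌋ * ⌈ k /2⌉)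
k²+2k≤10⌊k/2⌋⌈k/2⌉ 1 (s≤s ())
k²+2k≤10⌊k/2⌋⌈k/2⌉ 2 _ = m≤m+n 8 2
k²+2k≤10⌊k/2⌋⌈k/2⌉ 3 _ = m≤m+n 15 5
k²+2k≤10⌊k/2⌋⌈k/2⌉ (suc (suc k@(suc (suc _)))) _ =
  add-two {p = ⌊ k /2⌋} {⌈ k /2⌉} (⌊n/2⌋+⌈n/2⌉≡n k)
    (k²+2k≤10⌊k/2⌋⌈k/2⌉ k (s≤s (s≤s z≤n)))
  where
  add-two : ∀ {k p q} → p + q ≡ k → k * k + 2 * k ≤ 10 * (p * q) →
            (2 + k) * (2 + k) + 2 * (2 + k) ≤ 10 * (suc p * suc q)
  add-two {k} {p} {q} refl ih = begin
    (2 + k) * (2 + k) + 2 * (2 + k)   ≡⟨ e₁ k ⟩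
    (k * k + 2 * k) + (4 * k + 8)     ≤⟨ +-mono-≤ ih (+-mono-≤ (*-monoˡ-≤ k (m≤m+n 4 6))
                                                                (m≤m+n 8 2)) ⟩
    10 * (p * q) + (10 * k + 10)      ≡⟨ e₂ p q ⟩
    10 * (suc p * suc q)              ∎
    where
    open ≤-Reasoning
    e₁ : ∀ k → (2 + k) * (2 + k) + 2 * (2 + k) ≡ (k * k + 2 * k) + (4 * k + 8)
    e₁ = solve-∀
    e₂ : ∀ p q → 10 * (p * q) + (10 * (p + q) + 10) ≡ 10 * (suc p * suc q)
    e₂ = solve-∀

≤24*-from-halves : ∀ {m k L} → 2 ≤ k → m < suc k * suc k →
                   5 * ⌊ k /2⌋ * ⌈ k /2⌉ ≤ 12 * L → m ≤ 24 * L
≤24*-from-halves {m} {k} {L} 2≤k m<[1+k]² 5ab≤12L = begin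
  m                        ≤⟨ ≤-pred (≤-trans m<[1+k]² (≤-reflexive (e₁ k))) ⟩
  k * k + 2 * k            ≤⟨ k²+2k≤10⌊k/2⌋⌈k/2⌉ k 2≤k ⟩
  10 * (a * b)             ≡⟨ e₂ a b ⟩
  2 * (5 * a * b)          ≤⟨ *-monoʳ-≤ 2 5ab≤12L ⟩
  2 * (12 * L)             ≡⟨ *-assoc 2 12 L ⟨
  24 * L                   ∎
  where
  open ≤-Reasoning
  a b : ℕ
  a = ⌊ k /2⌋
  b = ⌈ k /2⌉
  e₁ : ∀ k → suc k * suc k ≡ suc (k * k + 2 * k)
  e₁ = solve-∀
  e₂ : ∀ a b → 10 * (a * b) ≡ 2 * (5 * a * b)
  e₂ = solve-∀

module PairLengths {X : Set} (c : X → X → ℕ) where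

  PairLength : List X → ℕ → Set
  PairLength F ℓ = ∃₂ λ e f → e ∈ F × f ∈ F × e ≢ f × ℓ ≡ c e f

  PairLength-mono : ∀ {F F′ ℓ} → F ⊆ F′ → PairLength F ℓ → PairLength F′ ℓ
  PairLength-mono F⊆F′ (e , f , e∈F , f∈F , e≢f , ℓ≡) =
    e , f , F⊆F′ e∈F , F⊆F′ f∈F , e≢f , ℓ≡

  Sparse : List X → Set
  Sparse R = ∀ e e′ → e ∈ R → e′ ∈ R → ¬ e ≡ e′
    → ∀ x y → x ∈ R → y ∈ R
    → ¬ x ≡ e → ¬ x ≡ e′ → c e e′ ≡ c e x
    → ¬ y ≡ e → ¬ y ≡ e′ → c e e′ ≡ c e y
    → x ≡ y

  -- g is c e only up to pointwise equality, so that the fibres of λ x → c x e are covered too.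
  Sparse⇒AtMostTwice : ∀ {R xs e} → Sparse R → e ∈ R → Unique xs → xs ⊆ R → e ∉ xs →
    (g : X → ℕ) → (∀ x → g x ≡ c e x) → AtMostTwice g xs
  Sparse⇒AtMostTwice {R} {xs} {e} sparse e∈R xs! xs⊆R e∉xs g g≗ = fibres≤2 λ ℓ →
    ≤-trans (≤-reflexive (count≡length∘filter (λ x → g x ≟ ℓ) xs))
            (Unique⇒length≤2 (filter⁺ (λ x → g x ≟ ℓ) xs!) (two-apart ℓ))
    where
    ≢e : ∀ {x} → x ∈ xs → x ≢ e
    ≢e x∈xs refl = e∉xs x∈xs
    same : ∀ {x y ℓ} → g x ≡ ℓ → g y ≡ ℓ → c e x ≡ c e y
    same {x} {y} gx≡ℓ gy≡ℓ = trans (sym (g≗ x)) (trans gx≡ℓ (trans (sym gy≡ℓ) (g≗ y)))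
    two-apart : ∀ ℓ {x y z} → let fibre = filter (λ x → g x ≟ ℓ) xs in
                x ∈ fibre → y ∈ fibre → z ∈ fibre → y ≢ x → z ≢ x → y ≡ z
    two-apart ℓ x∈ y∈ z∈ y≢x z≢x
      with x∈xs , gx≡ℓ ← ∈-filter⁻ (λ x → g x ≟ ℓ) x∈
         | y∈xs , gy≡ℓ ← ∈-filter⁻ (λ x → g x ≟ ℓ) y∈
         | z∈xs , gz≡ℓ ← ∈-filter⁻ (λ x → g x ≟ ℓ) z∈ =
      sparse e _ e∈R (xs⊆R x∈xs) (λ e≡x → ≢e x∈xs (sym e≡x))
             _ _ (xs⊆R y∈xs) (xs⊆R z∈xs)
             (≢e y∈xs) y≢x (same gx≡ℓ gy≡ℓ)
             (≢e z∈xs) z≢x (same gx≡ℓ gz≡ℓ)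

  module Greedy (c-comm : ∀ x y → c x y ≡ c y x) {R : List X} (R! : Unique R)
                (sparse : Sparse R) (a : ℕ) (a≤m : a ≤ length R) where

    m : ℕ
    m = length R

    A : List X
    A = take a R

    length-A : length A ≡ a
    length-A = trans (length-take a R) (m≤n⇒m⊓n≡m a≤m)

    record Stage (j : ℕ) : Set where
      field
        chosen pool : List X
        lengths : List ℕ
        layout : (chosen ++ A) ++ pool ↭ R
        length-chosen : length chosen ≡ j
        lengths! : Unique lengths
        lengths-realised : All (PairLength (chosen ++ A)) lengths
        progress : m ≤ 24 * length lengths ⊎ 5 * a * j ≤ 12 * length lengths

    initial : Stage 0
    initial = record
      { chosen = []
      ; pool = drop a R
      ; lengths = []
      ; layout = ↭-reflexive (take++drop≡id a R)
      ; length-chosen = refl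
      ; lengths! = []
      ; lengths-realised = []
      ; progress = inj₂ (≤-reflexive (*-zeroʳ (5 * a)))
      }

    module Layout {j} (s : Stage j) where
      open Stage s public

      F : List X
      F = chosen ++ A

      F++pool! : Unique (F ++ pool)
      F++pool! = Unique-resp-↭ (↭-sym layout) R!

      F! : Unique F
      F! = proj₁ (Unique-++⁻ F F++pool!)

      pool! : Unique pool
      pool! = proj₁ (proj₂ (Unique-++⁻ F F++pool!))

      A! : Unique A
      A! = proj₁ (proj₂ (Unique-++⁻ chosen F!))

      F⊆R : F ⊆ R
      F⊆R = ∈-resp-↭ layout ∘ ∈-++⁺ˡ

      A⊆F : A ⊆ F
      A⊆F = ∈-++⁺ʳ chosen

      pool⊆R : pool ⊆ R
      pool⊆R = ∈-resp-↭ layout ∘ ∈-++⁺ʳ F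

      F∉pool : ∀ {x} → x ∈ F → x ∉ pool
      F∉pool x∈F x∈pool = proj₂ (proj₂ (Unique-++⁻ F F++pool!)) (x∈F , x∈pool)

      size : (j + a) + length pool ≡ m
      size = begin
        (j + a) + length pool
          ≡⟨ cong₂ (λ u v → (u + v) + length pool) length-chosen length-A ⟨
        (length chosen + length A) + length pool  ≡⟨ cong (_+ length pool) (length-++ chosen) ⟨
        length F + length pool                    ≡⟨ length-++ F ⟨
        length (F ++ pool)                        ≡⟨ ↭-length layout ⟩
        m                                         ∎
        where open ≡-Reasoning

    module Step {j} (s : Stage j) (room : 2 * suc (j + a) ≤ m) where
      open Layout s

      pool-long : m < 2 * length pool
      pool-long = less-than-half-used size room

      pool-nonempty : 0 < length pool
      pool-nonempty = *-cancelˡ-< 2 0 (length pool) (≤-<-trans z≤n pool-long)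

      collisions : X → ℕ
      collisions f = count (λ e → c e f ∈? lengths) A

      total-collisions : ∑ pool collisions ≤ a * (2 * length lengths)
      total-collisions = begin
        ∑ pool collisions                                 ≡⟨ ∑-comm _ pool A ⟩
        ∑[ e ∈ A ] count (λ f → c e f ∈? lengths) pool    ≤⟨ ∑-mono-≤ (All.tabulate per-e) ⟩
        ∑[ _ ∈ A ] (2 * length lengths)                   ≡⟨ ∑-const A _ ⟩
        length A * (2 * length lengths)                   ≡⟨ cong (_* _) length-A ⟩
        a * (2 * length lengths)                          ∎
        where
        open ≤-Reasoning
        per-e : ∀ {e} → e ∈ A → count (λ f → c e f ∈? lengths) pool ≤ 2 * length lengths
        per-e {e} e∈A = count-∈≤2*length {g = c e}
          (Sparse⇒AtMostTwice sparse (F⊆R (A⊆F e∈A)) pool! pool⊆R (F∉pool (A⊆F e∈A))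
                              (c e) (λ _ → refl))
          lengths

      best : ∃ λ f → f ∈ pool × length pool * collisions f ≤ ∑ pool collisions
      best = below-average collisions pool pool-nonempty

      f : X
      f = proj₁ best

      f∈pool : f ∈ pool
      f∈pool = proj₁ (proj₂ best)

      rest : List X
      rest = proj₁ (∈⇒↭∷ f∈pool)

      f∉F : f ∉ F
      f∉F f∈F = F∉pool f∈F f∈pool

      layout′ : ((f ∷ chosen) ++ A) ++ rest ↭ R
      layout′ = ↭-trans (↭-sym (shift f F rest))
                  (↭-trans (++⁺ˡ F (↭-sym (proj₂ (∈⇒↭∷ f∈pool)))) layout)

      advance : (L′ : List ℕ) → Unique L′ → All (PairLength (f ∷ F)) L′ →
                m ≤ 24 * length L′ ⊎ 5 * a * suc j ≤ 12 * length L′ → Stage (suc j)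
      advance L′ L′! L′-realised progress′ = record
        { chosen = f ∷ chosen
        ; pool = rest
        ; lengths = L′
        ; layout = layout′
        ; length-chosen = cong suc length-chosen
        ; lengths! = L′!
        ; lengths-realised = L′-realised
        ; progress = progress′
        }

      old-realised : All (PairLength (f ∷ F)) lengths
      old-realised = All.map (PairLength-mono there) lengths-realised

      module Extend (short : ¬ m ≤ 24 * length lengths) where
        unrecorded? : Decidable (λ e → c e f ∉ lengths)
        unrecorded? e = ¬? (c e f ∈? lengths)

        fresh : List X
        fresh = filter unrecorded? A

        new : List ℕ
        new = deduplicate _≟_ (map (λ e → c e f) fresh)

        fresh⊆A : fresh ⊆ A
        fresh⊆A = proj₁ ∘ ∈-filter⁻ unrecorded? {xs = A}

        few-collisions : 6 * collisions f ≤ a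
        few-collisions = collisions≤a/6 {p = length pool} {L = length lengths}
          {{>-nonZero pool-nonempty}} (≤-trans (proj₂ (proj₂ best)) total-collisions)
          (<⇒≤ (≰⇒> short)) (<⇒≤ pool-long)

        fresh-size : collisions f + length fresh ≡ a
        fresh-size = begin
          collisions f + length fresh
            ≡⟨ cong (collisions f +_) (count≡length∘filter unrecorded? A) ⟨
          collisions f + count unrecorded? A  ≡⟨ count+count-¬ (λ e → c e f ∈? lengths) A ⟩
          length A                            ≡⟨ length-A ⟩
          a                                   ∎
          where open ≡-Reasoning

        fresh-twice : AtMostTwice (λ e → c e f) fresh
        fresh-twice = Sparse⇒AtMostTwice sparse (pool⊆R f∈pool) (filter⁺ unrecorded? A!)
          (F⊆R ∘ A⊆F ∘ fresh⊆A) (f∉F ∘ A⊆F ∘ fresh⊆A) _ (λ e → c-comm e f)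

        gain : 5 * a ≤ 12 * length new
        gain = new≥5a/12 {y = length new} fresh-size (length≤2*distinct-values fresh-twice)
                 few-collisions

        new-value : ∀ {ℓ} → ℓ ∈ new → ∃ λ e → e ∈ fresh × ℓ ≡ c e f
        new-value ℓ∈new = ∈-map⁻ (λ e → c e f) (∈-deduplicate⁻ _≟_ _ ℓ∈new)

        new#lengths : Disjoint new lengths
        new#lengths (ℓ∈new , ℓ∈L) =
          let e , e∈fresh , ℓ≡ = new-value ℓ∈new in
          proj₂ (∈-filter⁻ unrecorded? {xs = A} e∈fresh) (subst (_∈ lengths) ℓ≡ ℓ∈L)

        new-realised : All (PairLength (f ∷ F)) new
        new-realised = All.tabulate λ ℓ∈new →
          let e , e∈fresh , ℓ≡ = new-value ℓ∈new
              e∈F = A⊆F (fresh⊆A e∈fresh)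
          in e , f , there e∈F , here refl , (λ e≡f → f∉F (subst (_∈ F) e≡f e∈F)) , ℓ≡

        progress′ : 5 * a * suc j ≤ 12 * length (new ++ lengths)
        progress′ = [ (λ long → contradiction long short) , extend ]′ progress
          where
          open ≤-Reasoning
          extend : 5 * a * j ≤ 12 * length lengths →
                   5 * a * suc j ≤ 12 * length (new ++ lengths)
          extend before = begin
            5 * a * suc j                           ≡⟨ *-suc (5 * a) j ⟩
            5 * a + 5 * a * j                       ≤⟨ +-mono-≤ gain before ⟩
            12 * length new + 12 * length lengths   ≡⟨ *-distribˡ-+ 12 (length new) (length lengths) ⟨
            12 * (length new + length lengths)      ≡⟨ cong (12 *_) (length-++ new) ⟨
            12 * length (new ++ lengths)            ∎

        next : Stage (suc j)
        next = advance (new ++ lengths) (++⁺ (deduplicate-! _) lengths! new#lengths)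
                 (All.++⁺ new-realised old-realised) (inj₂ progress′)

      next : Stage (suc j)
      next with m ≤? 24 * length lengths
      ... | yes long  = advance lengths lengths! old-realised (inj₁ long)  -- f merely pads F
      ... | no  short = Extend.next short

    stage : ∀ j → 2 * (j + a) ≤ m → Stage j
    stage zero    _    = initial
    stage (suc j) room = Step.next (stage j (≤-trans (*-monoʳ-≤ 2 (n≤1+n (j + a))) room)) room

  PairLengthSelection : List X → ℕ → Set
  PairLengthSelection R k = ∃ λ F → Unique F × F ⊆ R × length F ≡ k ×
    ∃ λ L → Unique L × All (PairLength F) L × length R ≤ 24 * length L

  many-pair-lengths : (∀ x y → c x y ≡ c y x) → ∀ {R} → Unique R → Sparse R →
    ∀ k → 2 ≤ k → k * k ≤ length R → length R < suc k * suc k → PairLengthSelection R k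
  many-pair-lengths c-comm {R} R! sparse k 2≤k k²≤m m<[1+k]² =
    F , F! , F⊆R , length-F , lengths , lengths! , lengths-realised ,
    [ id , ≤24*-from-halves {L = length lengths} 2≤k m<[1+k]² ]′ progress
    where
    halves : ⌈ k /2⌉ + ⌊ k /2⌋ ≡ k
    halves = trans (+-comm ⌈ k /2⌉ ⌊ k /2⌋) (⌊n/2⌋+⌈n/2⌉≡n k)
    2k≤m : 2 * k ≤ length R
    2k≤m = ≤-trans (*-monoˡ-≤ k 2≤k) k²≤m
    open Greedy c-comm R! sparse ⌊ k /2⌋
      (≤-trans (⌊n/2⌋≤n k) (≤-trans (m≤m+n k (k + 0)) 2k≤m))
    open Layout (stage ⌈ k /2⌉ (subst (λ t → 2 * t ≤ length R) (sym halves) 2k≤m))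
    length-F : length F ≡ k
    length-F = trans (length-++ chosen) (trans (cong₂ _+_ length-chosen length-A) halves)

data Walk {V : Set} (E : V → V → Set) : V → List V → V → Set where
  idle : ∀ x → Walk E x [ x ] x
  step : ∀ {x y ys z} → E x y → Walk E y ys z → Walk E x (x ∷ ys) z

module _ {V : Set} {E : V → V → Set} where

  walk-++ : ∀ {x xs y z zs w} → Walk E x xs y → E y z → Walk E z zs w → Walk E x (xs ++ zs) w
  walk-++ (idle x)      e w = step e w
  walk-++ (step e′ w′) e w = step e′ (walk-++ w′ e w)

  walk-reverse : (∀ {x y} → E x y → E y x) →
                 ∀ {x xs y} → Walk E x xs y → Walk E y (reverse xs) x
  walk-reverse E-sym (idle x) = idle x
  walk-reverse E-sym (step {x} {ys = ys} e w) rewrite unfold-reverse x ys =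
    walk-++ (walk-reverse E-sym w) (E-sym e) (idle x)

  walk-nonempty : ∀ {x xs y} → Walk E x xs y → 1 ≤ length xs
  walk-nonempty (idle _)   = s≤s z≤n
  walk-nonempty (step _ _) = s≤s z≤n

  walk⇒Linked : ∀ {x xs y} → Walk E x xs y → Linked E xs
  walk⇒Linked (idle _)              = [-]
  walk⇒Linked (step e (idle _))     = e ∷ [-]
  walk⇒Linked (step e w@(step _ _)) = e ∷ walk⇒Linked w

Vertex : ℕ → ℕ → Set
Vertex n z = 1 ≤ z × z ≤ n

closed-walk-cycle : ∀ {E n x xs y} → Walk E x xs y → E y x →
  3 ≤ length xs → Unique xs → All (Vertex n) xs → IsCycle E n xs
closed-walk-cycle w@(idle x)   e long xs! xs⊆V =
  long , xs! , xs⊆V , walk⇒Linked (walk-++ w e (idle x))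
closed-walk-cycle w@(step _ _) e long xs! xs⊆V =
  long , xs! , xs⊆V , walk⇒Linked (walk-++ w e (idle _))

range≡applyUpTo : ∀ x y → range x y ≡ applyUpTo (x +_) (suc (y ∸ x))
range≡applyUpTo x y = map-applyUpTo (λ i → i) (x +_) (suc (y ∸ x))

range-length : ∀ x y → length (range x y) ≡ suc (y ∸ x)
range-length x y = trans (length-map (x +_) (upTo (suc (y ∸ x)))) (length-upTo (suc (y ∸ x)))

range-unique : ∀ x y → Unique (range x y)
range-unique x y = map⁺ (+-cancelˡ-≡ x _ _) (upTo⁺ _)

range-bounds : ∀ {x y z} → x ≤ y → z ∈ range x y → x ≤ z × z ≤ y
range-bounds {x} {y} x≤y z∈range with i , i∈upTo , refl ← ∈-map⁻ (x +_) z∈range =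
  m≤m+n x i , subst (x + i ≤_) (m+[n∸m]≡n x≤y) (+-monoʳ-≤ x (s≤s⁻¹ (∈-upTo⁻ i∈upTo)))

applyUpTo-walk : ∀ {E : ℕ → ℕ → Set} (f : ℕ → ℕ) d →
  (∀ i → i < d → E (f i) (f (suc i))) → Walk E (f 0) (applyUpTo f (suc d)) (f d)
applyUpTo-walk f zero    _     = idle (f 0)
applyUpTo-walk f (suc d) edges =
  step (edges 0 z<s) (applyUpTo-walk (λ i → f (suc i)) d (λ i i<d → edges (suc i) (s<s i<d)))

range-walk : ∀ {E : ℕ → ℕ → Set} {x y} → x ≤ y →
  (∀ z → x ≤ z → z < y → E z (suc z)) → Walk E x (range x y) y
range-walk {E} {x} {y} x≤y edges =
  subst (λ xs → Walk E x xs y) (sym (range≡applyUpTo x y))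
    (subst₂ (λ u v → Walk E u (applyUpTo (x +_) (suc (y ∸ x))) v)
            (+-identityʳ x) (m+[n∸m]≡n x≤y)
      (applyUpTo-walk (x +_) (y ∸ x) λ i i<y∸x →
        subst (E (x + i)) (sym (+-suc x i))
          (edges (x + i) (m≤m+n x i) (subst (x + i <_) (m+[n∸m]≡n x≤y) (+-monoʳ-< x i<y∸x)))))

≡ᵇ-reflects-≡ : ∀ m n → Reflects (m ≡ n) (m ≡ᵇ n)
≡ᵇ-reflects-≡ m n = fromEquivalence (≡ᵇ⇒≡ m n) (≡⇒≡ᵇ m n)

cycC-comm : ∀ n e f → cycC n e f ≡ cycC n f e
cycC-comm n (a , b) (c , d) with c <ᵇ a | <ᵇ-reflects-< c a | a <ᵇ c | <ᵇ-reflects-< a c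
... | true  | ofʸ c<a | true  | ofʸ a<c = contradiction a<c (<-asym c<a)
... | true  | _       | false | _       = refl
... | false | _       | true  | _       = refl
... | false | ofⁿ c≮a | false | ofⁿ a≮c with ≤-antisym (≮⇒≥ a≮c) (≮⇒≥ c≮a)
... | refl with a ≡ᵇ a | ≡ᵇ-reflects-≡ a a
...   | false | ofⁿ a≢a = contradiction refl a≢a
...   | true  | _ with b <ᵇ d | <ᵇ-reflects-< b d | d <ᵇ b | <ᵇ-reflects-< d b
...     | true  | ofʸ b<d | true  | ofʸ d<b = contradiction d<b (<-asym b<d)
...     | true  | _       | false | _       = refl
...     | false | _       | true  | _       = refl
...     | false | ofⁿ b≮d | false | ofⁿ d≮b
  rewrite ≤-antisym (≮⇒≥ d≮b) (≮⇒≥ b≮d) = refl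

module Cycles (n : ℕ) (F : List Edge) where

  infix 4 _~_
  _~_ : ℕ → ℕ → Set
  _~_ = Adj n F

  ~-sym : ∀ {x y} → x ~ y → y ~ x
  ~-sym (inj₁ (inj₁ h))               = inj₁ (inj₂ (inj₁ h))
  ~-sym (inj₁ (inj₂ (inj₁ h)))        = inj₁ (inj₁ h)
  ~-sym (inj₁ (inj₂ (inj₂ (inj₁ h)))) = inj₁ (inj₂ (inj₂ (inj₂ (proj₂ h , proj₁ h))))
  ~-sym (inj₁ (inj₂ (inj₂ (inj₂ h)))) = inj₁ (inj₂ (inj₂ (inj₁ (proj₂ h , proj₁ h))))
  ~-sym (inj₂ (inj₁ xy∈F))            = inj₂ (inj₂ xy∈F)
  ~-sym (inj₂ (inj₂ yx∈F))            = inj₂ (inj₁ yx∈F)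

  chord : ∀ {x y} → (x , y) ∈ F → x ~ y
  chord xy∈F = inj₂ (inj₁ xy∈F)

  wrap-edge : n ~ 1
  wrap-edge = inj₁ (inj₂ (inj₂ (inj₂ (refl , refl))))

  up-walk : ∀ {x y} → 1 ≤ x → x ≤ y → y ≤ n → Walk _~_ x (range x y) y
  up-walk 1≤x x≤y y≤n = range-walk x≤y λ z x≤z z<y →
    inj₁ (inj₁ (≤-trans 1≤x x≤z , <-≤-trans z<y y≤n , refl))

  range-vertices : ∀ {x y} → 1 ≤ x → x ≤ y → y ≤ n → All (Vertex n) (range x y)
  range-vertices 1≤x x≤y y≤n = All.tabulate λ z∈range →
    let x≤z , z≤y = range-bounds x≤y z∈range in ≤-trans 1≤x x≤z , ≤-trans z≤y y≤n

  hamilton-cycle : 3 ≤ n → InCycleSet n F n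
  hamilton-cycle 3≤n = range 1 n ,
    closed-walk-cycle (up-walk ≤-refl 1≤n ≤-refl) wrap-edge
      (subst (3 ≤_) (sym length≡n) 3≤n) (range-unique 1 n) (range-vertices ≤-refl 1≤n ≤-refl) ,
    length≡n
    where
    1≤n : 1 ≤ n
    1≤n = ≤-trans (s≤s z≤n) 3≤n
    length≡n : length (range 1 n) ≡ n
    length≡n = trans (range-length 1 n) (m+[n∸m]≡n 1≤n)

  record Arc (u : ℕ) (P : List ℕ) (v : ℕ) : Set where
    field
      walk : Walk _~_ u P v
      unique : Unique P
      vertices : All (Vertex n) P

  -- Every C(e,f) consists of two arcs of H (possibly single vertices) joined by e and f.
  two-arc-cycle : ∀ {u P v u′ Q v′} → Arc u P v → v ~ u′ → Arc u′ Q v′ → v′ ~ u →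
    2 ≤ length Q → Disjoint P Q → IsCycle _~_ n (P ++ Q)
  two-arc-cycle {P = P} α e β e′ 2≤|Q| P#Q =
    closed-walk-cycle (walk-++ (Arc.walk α) e (Arc.walk β)) e′
      (subst (3 ≤_) (sym (length-++ P)) (+-mono-≤ (walk-nonempty (Arc.walk α)) 2≤|Q|))
      (++⁺ (Arc.unique α) (Arc.unique β) P#Q)
      (All.++⁺ (Arc.vertices α) (Arc.vertices β))

  point : ∀ {x} → Vertex n x → Arc x [ x ] x
  point x∈V = record { walk = idle _ ; unique = [] ∷ [] ; vertices = x∈V ∷ [] }

  up : ∀ {x y} → 1 ≤ x → x ≤ y → y ≤ n → Arc x (range x y) y
  up {x} {y} 1≤x x≤y y≤n = record
    { walk = up-walk 1≤x x≤y y≤n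
    ; unique = range-unique x y
    ; vertices = range-vertices 1≤x x≤y y≤n
    }

  down : ∀ {x y} → 1 ≤ x → x ≤ y → y ≤ n → Arc y (reverse (range x y)) x
  down {x} {y} 1≤x x≤y y≤n = record
    { walk = walk-reverse ~-sym (up-walk 1≤x x≤y y≤n)
    ; unique = Unique-resp-↭ (↭-sym (↭-reverse (range x y))) (range-unique x y)
    ; vertices = All-resp-↭ (↭-sym (↭-reverse (range x y))) (range-vertices 1≤x x≤y y≤n)
    }

  wrap : ∀ {a d} → 1 ≤ a → a < d → d ≤ n → Arc d (range d n ++ range 1 a) a
  wrap {a} {d} 1≤a a<d d≤n = record
    { walk = walk-++ (Arc.walk upper) wrap-edge (Arc.walk lower)
    ; unique = ++⁺ (Arc.unique upper) (Arc.unique lower) λ (z∈upper , z∈lower) →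
        <⇒≱ a<d (≤-trans (proj₁ (range-bounds d≤n z∈upper))
                         (proj₂ (range-bounds 1≤a z∈lower)))
    ; vertices = All.++⁺ (Arc.vertices upper) (Arc.vertices lower)
    }
    where
    upper : Arc d (range d n) n
    upper = up (≤-trans 1≤a (<⇒≤ a<d)) d≤n ≤-refl
    lower : Arc 1 (range 1 a) a
    lower = up ≤-refl 1≤a (≤-trans (<⇒≤ a<d) d≤n)

  wrap-bounds : ∀ {a d z} → 1 ≤ a → d ≤ n → z ∈ range d n ++ range 1 a → d ≤ z ⊎ z ≤ a
  wrap-bounds {d = d} 1≤a d≤n z∈wrap with ∈-++⁻ (range d n) z∈wrap
  ... | inj₁ z∈upper = inj₁ (proj₁ (range-bounds d≤n z∈upper))
  ... | inj₂ z∈lower = inj₂ (proj₂ (range-bounds 1≤a z∈lower))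

  range-long : ∀ {x y} → x < y → 2 ≤ length (range x y)
  range-long {x} {y} x<y = subst (2 ≤_) (sym (range-length x y)) (s≤s (m<n⇒0<n∸m x<y))

  wrap-long : ∀ a d → 2 ≤ length (range d n ++ range 1 a)
  wrap-long a d = subst (2 ≤_) (sym (length-++ (range d n)))
    (+-mono-≤ (range-nonempty d n) (range-nonempty 1 a))
    where
    range-nonempty : ∀ x y → 1 ≤ length (range x y)
    range-nonempty x y = subst (1 ≤_) (sym (range-length x y)) (s≤s z≤n)

  shared-left-cycle : ∀ {a x y} → (a , x) ∈ F → (a , y) ∈ F →
    1 ≤ a → a < x → x < y → y ≤ n → IsCycle _~_ n (a ∷ range x y)
  shared-left-cycle ax∈F ay∈F 1≤a a<x x<y y≤n =
    two-arc-cycle (point (1≤a , ≤-trans (<⇒≤ (<-trans a<x x<y)) y≤n)) (chord ax∈F)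
      (up (≤-trans 1≤a (<⇒≤ a<x)) (<⇒≤ x<y) y≤n) (~-sym (chord ay∈F)) (range-long x<y)
      λ { (here refl , a∈range) → <⇒≱ a<x (proj₁ (range-bounds (<⇒≤ x<y) a∈range)) }

  shared-right-cycle : ∀ {x y b} → (x , b) ∈ F → (y , b) ∈ F →
    1 ≤ x → x < y → y < b → b ≤ n → IsCycle _~_ n (b ∷ range x y)
  shared-right-cycle xb∈F yb∈F 1≤x x<y y<b b≤n =
    two-arc-cycle (point (≤-trans 1≤x (<⇒≤ (<-trans x<y y<b)) , b≤n)) (~-sym (chord xb∈F))
      (up 1≤x (<⇒≤ x<y) (≤-trans (<⇒≤ y<b) b≤n)) (chord yb∈F) (range-long x<y)
      λ { (here refl , b∈range) → <⇒≱ y<b (proj₂ (range-bounds (<⇒≤ x<y) b∈range)) }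

  adjacent-cycle : ∀ {a b d} → (a , b) ∈ F → (b , d) ∈ F →
    1 ≤ a → a < b → b < d → d ≤ n → IsCycle _~_ n (b ∷ (range d n ++ range 1 a))
  adjacent-cycle {a} {b} {d} ab∈F bd∈F 1≤a a<b b<d d≤n =
    two-arc-cycle (point (≤-trans 1≤a (<⇒≤ a<b) , ≤-trans (<⇒≤ b<d) d≤n)) (chord bd∈F)
      (wrap 1≤a (<-trans a<b b<d) d≤n) (chord ab∈F) (wrap-long a d)
      λ { (here refl , b∈wrap) → [ <⇒≱ b<d , <⇒≱ a<b ]′ (wrap-bounds 1≤a d≤n b∈wrap) }

  separated-cycle : ∀ {a b c d} → (a , b) ∈ F → (c , d) ∈ F →
    1 ≤ a → a < b → b < c → c < d → d ≤ n →
    IsCycle _~_ n (range b c ++ (range d n ++ range 1 a))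
  separated-cycle {a} {b} {c} {d} ab∈F cd∈F 1≤a a<b b<c c<d d≤n =
    two-arc-cycle (up (≤-trans 1≤a (<⇒≤ a<b)) (<⇒≤ b<c) (≤-trans (<⇒≤ c<d) d≤n))
      (chord cd∈F)
      (wrap 1≤a (<-trans a<b (<-trans b<c c<d)) d≤n) (chord ab∈F) (wrap-long a d)
      λ (z∈middle , z∈wrap) → let b≤z , z≤c = range-bounds (<⇒≤ b<c) z∈middle in
        [ (λ d≤z → <⇒≱ c<d (≤-trans d≤z z≤c))
        , (λ z≤a → <⇒≱ a<b (≤-trans b≤z z≤a))
        ]′ (wrap-bounds 1≤a d≤n z∈wrap)

  nested-cycle : ∀ {a b c d} → (a , b) ∈ F → (c , d) ∈ F →
    1 ≤ a → a < c → c < d → d < b → b ≤ n → IsCycle _~_ n (range a c ++ range d b)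
  nested-cycle ab∈F cd∈F 1≤a a<c c<d d<b b≤n =
    two-arc-cycle (up 1≤a (<⇒≤ a<c) (≤-trans (<⇒≤ (<-trans c<d d<b)) b≤n)) (chord cd∈F)
      (up (≤-trans 1≤a (<⇒≤ (<-trans a<c c<d))) (<⇒≤ d<b) b≤n) (~-sym (chord ab∈F))
      (range-long d<b)
      λ (z∈left , z∈right) →
        <⇒≱ c<d (≤-trans (proj₁ (range-bounds (<⇒≤ d<b) z∈right))
                         (proj₂ (range-bounds (<⇒≤ a<c) z∈left)))

  crossing-cycle : ∀ {a b c d} → (a , b) ∈ F → (c , d) ∈ F →
    1 ≤ a → a < c → c < b → b < d → d ≤ n → IsCycle _~_ n (range b d ++ reverse (range a c))
  crossing-cycle {a} {b} {c} {d} ab∈F cd∈F 1≤a a<c c<b b<d d≤n =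
    two-arc-cycle (up (≤-trans 1≤a (<⇒≤ (<-trans a<c c<b))) (<⇒≤ b<d) d≤n)
      (~-sym (chord cd∈F))
      (down 1≤a (<⇒≤ a<c) (≤-trans (<⇒≤ (<-trans c<b b<d)) d≤n)) (chord ab∈F)
      (subst (2 ≤_) (sym (length-reverse (range a c))) (range-long a<c))
      λ (z∈right , z∈left) →
        <⇒≱ c<b (≤-trans (proj₁ (range-bounds (<⇒≤ b<d) z∈right))
                         (proj₂ (range-bounds (<⇒≤ a<c) (Any.reverse⁻ z∈left))))

  cycC-isCycle-≡ : ∀ {a b d} → (a , b) ∈ F → (a , d) ∈ F → b ≢ d →
    1 ≤ a → a < b → b ≤ n → a < d → d ≤ n → IsCycle _~_ n (cycC n (a , b) (a , d))
  cycC-isCycle-≡ {a} {b} {d} ab∈F ad∈F b≢d 1≤a a<b b≤n a<d d≤n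
    with a <ᵇ a | <ᵇ-reflects-< a a
  ... | true  | ofʸ a<a = contradiction a<a (<-irrefl refl)
  ... | false | _ with a ≡ᵇ a | ≡ᵇ-reflects-≡ a a
  ... | false | ofⁿ a≢a = contradiction refl a≢a
  ... | true  | _ with b <ᵇ d | <ᵇ-reflects-< b d
  ... | true  | ofʸ b<d = shared-left-cycle ab∈F ad∈F 1≤a a<b b<d d≤n
  ... | false | ofⁿ b≮d = shared-left-cycle ad∈F ab∈F 1≤a a<d d<b b≤n
    where
    d<b : d < b
    d<b = ≤∧≢⇒< (≮⇒≥ b≮d) (b≢d ∘ sym)

  cycC-isCycle-< : ∀ {a b c d} → (a , b) ∈ F → (c , d) ∈ F →
    1 ≤ a → a < b → b ≤ n → a < c → c < d → d ≤ n → IsCycle _~_ n (cycC n (a , b) (c , d))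
  cycC-isCycle-< {a} {b} {c} {d} ab∈F cd∈F 1≤a a<b b≤n a<c c<d d≤n
    with c <ᵇ a | <ᵇ-reflects-< c a
  ... | true  | ofʸ c<a = contradiction c<a (<-asym a<c)
  ... | false | _ with a ≡ᵇ c | ≡ᵇ-reflects-≡ a c
  ... | true  | ofʸ a≡c = contradiction a≡c (<⇒≢ a<c)
  ... | false | _ with b <ᵇ c | <ᵇ-reflects-< b c
  ... | true  | ofʸ b<c = separated-cycle ab∈F cd∈F 1≤a a<b b<c c<d d≤n
  ... | false | ofⁿ b≮c with b ≡ᵇ c | ≡ᵇ-reflects-≡ b c
  ... | true  | ofʸ refl = adjacent-cycle ab∈F cd∈F 1≤a a<b c<d d≤n
  ... | false | ofⁿ b≢c with d <ᵇ b | <ᵇ-reflects-< d b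
  ... | true  | ofʸ d<b = nested-cycle ab∈F cd∈F 1≤a a<c c<d d<b b≤n
  ... | false | ofⁿ d≮b with d ≡ᵇ b | ≡ᵇ-reflects-≡ d b
  ... | true  | ofʸ refl = shared-right-cycle ab∈F cd∈F 1≤a a<c c<d d≤n
  ... | false | ofⁿ d≢b = crossing-cycle ab∈F cd∈F 1≤a a<c c<b b<d d≤n
    where
    c<b : c < b
    c<b = ≤∧≢⇒< (≮⇒≥ b≮c) (b≢c ∘ sym)
    b<d : b < d
    b<d = ≤∧≢⇒< (≮⇒≥ d≮b) (d≢b ∘ sym)

  cycC-isCycle : ∀ {e f} → e ∈ F → f ∈ F → IsChord n e → IsChord n f → e ≢ f →
    IsCycle _~_ n (cycC n e f)
  cycC-isCycle {a , b} {c , d} e∈F f∈F (1≤a , a<b , b≤n , _) (1≤c , c<d , d≤n , _) e≢f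
    with <-cmp a c
  ... | tri< a<c _ _ = cycC-isCycle-< e∈F f∈F 1≤a a<b b≤n a<c c<d d≤n
  ... | tri≈ _ refl _ = cycC-isCycle-≡ e∈F f∈F (e≢f ∘ cong (a ,_)) 1≤a a<b b≤n c<d d≤n
  ... | tri> _ _ c<a = subst (IsCycle _~_ n) (cycC-comm n (c , d) (a , b))
                         (cycC-isCycle-< f∈F e∈F 1≤c c<d d≤n c<a a<b b≤n)

integer-sqrt : ∀ m → ∃ λ k → k * k ≤ m × m < suc k * suc k
integer-sqrt zero = 0 , z≤n , s≤s z≤n
integer-sqrt (suc m) with integer-sqrt m
... | k , k²≤m , m<[1+k]² with suc k * suc k ≤? suc m
... | yes [1+k]²≤1+m = suc k , [1+k]²≤1+m ,
                        ≤-<-trans m<[1+k]² (*-mono-< (n<1+n (suc k)) (n<1+n (suc k)))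
... | no  [1+k]²≰1+m = k , ≤-trans k²≤m (n≤1+n m) , ≰⇒> [1+k]²≰1+m

ManyCycleLengths : ℕ → List Edge → Set
ManyCycleLengths n R = Σ (List Edge) λ F → Unique F × All (_∈ R) F
  × length F * length F ≤ length R
  × length R < suc (length F) * suc (length F)
  × Σ (List ℕ) λ L → Unique L × All (InCycleSet n F) L
      × length R ≤ 24 * length L

no-chords : ∀ {n R} → length R < 1 → ManyCycleLengths n R
no-chords m<1 = [] , [] , [] , z≤n , m<1 , [] , [] , [] , ≤-pred m<1

few-chords : ∀ {n} → 3 ≤ n → (R : List Edge) → 1 ≤ length R → length R < 4 →
  ManyCycleLengths n R
few-chords {n} 3≤n (r ∷ _) 1≤m m<4 =
  r ∷ [] , [] ∷ [] , here refl ∷ [] , 1≤m , m<4 ,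
  n ∷ [] , [] ∷ [] , Cycles.hamilton-cycle n (r ∷ []) 3≤n ∷ [] ,
  ≤-trans (≤-pred m<4) (m≤m+n 3 21)

PairLength⇒InCycleSet : ∀ {n F ℓ} → All (IsChord n) F →
  PairLengths.PairLength (cycLen n) F ℓ → InCycleSet n F ℓ
PairLength⇒InCycleSet {n} {F} chords (e , f , e∈F , f∈F , e≢f , refl) =
  cycC n e f ,
  Cycles.cycC-isCycle n F e∈F f∈F (All.lookup chords e∈F) (All.lookup chords f∈F) e≢f ,
  refl

PairLengthSelection⇒ManyCycleLengths : ∀ {n R k} → All (IsChord n) R →
  k * k ≤ length R → length R < suc k * suc k →
  PairLengths.PairLengthSelection (cycLen n) R k → ManyCycleLengths n R
PairLengthSelection⇒ManyCycleLengths R-chords k²≤m m<[1+k]²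
  (F , F! , F⊆R , refl , L , L! , L-realised , m≤24L) =
  F , F! , All.tabulate F⊆R , k²≤m , m<[1+k]² ,
  L , L! , All.map (PairLength⇒InCycleSet (All.tabulate (All.lookup R-chords ∘ F⊆R))) L-realised ,
  m≤24L

lemma3p1 : (n : ℕ) → 3 ≤ n
    → (G : ℕ → ℕ → Set)
    → (∀ x y → G x y → 1 ≤ x × x ≤ n × 1 ≤ y × y ≤ n × ¬ x ≡ y)
    → (∀ x y → G x y → G y x)
    → (∀ x y → HEdge n x y → G x y)
    → (R : List Edge) → Unique R
    → All (λ e → IsChord n e × G (proj₁ e) (proj₂ e)) R
    → (∀ e e' → e ∈ R → e' ∈ R → ¬ e ≡ e'
        → ∀ x y → x ∈ R → y ∈ R
        → ¬ x ≡ e → ¬ x ≡ e' → cycLen n e e' ≡ cycLen n e x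
        → ¬ y ≡ e → ¬ y ≡ e' → cycLen n e e' ≡ cycLen n e y
        → x ≡ y)
    → Σ (List Edge) λ F → Unique F × All (_∈ R) F
        × length F * length F ≤ length R
        × length R < suc (length F) * suc (length F)
        × Σ (List ℕ) λ L → Unique L × All (InCycleSet n F) L
            × length R ≤ 24 * length L
-- G only restricts which chords R may contain; the cycles live in H + F.
lemma3p1 n 3≤n _ _ _ _ R R! R-chords sparse with integer-sqrt (length R)
... | 0           , _    , m<1      = no-chords m<1
... | 1           , 1≤m  , m<4      = few-chords 3≤n R 1≤m m<4
... | k@(suc (suc _)) , k²≤m , m<[1+k]² =
  PairLengthSelection⇒ManyCycleLengths (All.map proj₁ R-chords) k²≤m m<[1+k]²
    (PairLengths.many-pair-lengths (cycLen n) (λ e f → cong length (cycC-comm n e f))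
       R! sparse k (s≤s (s≤s z≤n)) k²≤m m<[1+k]²)
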